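{- Let $s \geq 3$ and let $G$ be the graph on the vertex set $R \cup T \cup W \cup Z$, where $R=\{r_{1},\dots,r_{s}\}$, $T=\{t_{1},\dots,t_{s}\}$, $W=\{w_{1},\dots,w_{s}\}$, $Z=\{z_{1},\dots,z_{s}\}$ are pairwise disjoint, whose edges are exactly: for each $1 \leq i \leq s$, $r_{i}$ is joined to every vertex of $(T \cup W)\setminus\{t_{i}\}$, $t_{i}$ is joined to every vertex of $(W \cup Z)\setminus\{w_{i}\}$, $w_{i}$ is joined to every vertex of $Z \setminus \{z_{i}\}$; and $R$ and $Z$ each induce a complete graph (so $T$ and $W$ are independent sets). Then $G$ is a maximal $3$-$\gamma_{c}$-vertex critical graph.
   Context: All graphs are finite and simple. A connected dominating set of $G$ is a set $D \subseteq V(G)$ such that every vertex of $G$ is in $D$ or adjacent to a vertex of $D$, and $G[D]$ is connected; $\gamma_{c}(G)$ is the minimum size of such a set. $G$ is $k$-$\gamma_{c}$-edge critical if $\gamma_{c}(G)=k$ and $\gamma_{c}(G+uv)<k$ for every pair of non-adjacent vertices $u,v$. A $2$-connected graph $G$ is $k$-$\gamma_{c}$-vertex critical if $\gamma_{c}(G)=k$ and $\gamma_{c}(G-v)<k$ for every $v \in V(G)$. $G$ is maximal $k$-$\gamma_{c}$-vertex critical if it is both $k$-$\gamma_{c}$-edge critical and $k$-$\gamma_{c}$-vertex critical. -}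

module Defs where

open import Data.Nat using (ℕ; zero; suc; pred; _<_; _≤_; _*_)
open import Data.Fin using (Fin; zero; suc; punchIn; remQuot; _≟_)
open import Data.Fin.Subset using (Subset; _∈_; ∣_∣; ⊤)
open import Data.Bool using (Bool; true; false; _∨_; _∧_; not)
open import Data.Bool.Properties using (∨-comm)
open import Data.Product using (_×_; _,_; ∃; ∃-syntax; Σ-syntax)
open import Data.Sum using (_⊎_)
open import Data.Empty using (⊥-elim)
open import Relation.Nullary using (yes; no; ¬_; does)
open import Relation.Binary.PropositionalEquality using (_≡_; refl)

record Graph (n : ℕ) : Set where
  field
    adj    : Fin n → Fin n → Bool
    sym    : ∀ x y → adj x y ≡ adj y x
    irrefl : ∀ x → adj x x ≡ false
open Graph public

-- Vertex deletion G - v (vertices of G - v are renumbered by punchIn v)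
_-ᵛ_ : ∀ {n} → Graph n → Fin n → Graph (pred n)
_-ᵛ_ {suc m} G v = record
  { adj    = λ i j → adj G (punchIn v i) (punchIn v j)
  ; sym    = λ i j → sym G (punchIn v i) (punchIn v j)
  ; irrefl = λ i → irrefl G (punchIn v i) }

eqᵇ : ∀ {n} → Fin n → Fin n → Bool
eqᵇ i j = does (i ≟ j)

eqᵇ-refl : ∀ {n} (i : Fin n) → eqᵇ i i ≡ true
eqᵇ-refl i with i ≟ i
... | yes _ = refl
... | no ¬p = ⊥-elim (¬p refl)

addEdge : ∀ {n} → Graph n → (u v : Fin n) → ¬ (u ≡ v) → Graph n
addEdge G u v u≢v = record
  { adj    = λ x y → adj G x y ∨ (e x y ∨ e y x)
  ; sym    = λ x y → sym' x y
  ; irrefl = irr }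
  where
  e : _ → _ → Bool
  e x y = eqᵇ x u ∧ eqᵇ y v
  sym' : ∀ x y → (adj G x y ∨ (e x y ∨ e y x)) ≡ (adj G y x ∨ (e y x ∨ e x y))
  sym' x y rewrite sym G x y | ∨-comm (e x y) (e y x) = refl
  irr : ∀ x → (adj G x x ∨ (e x x ∨ e x x)) ≡ false
  irr x rewrite irrefl G x with x ≟ u | x ≟ v
  ... | yes refl | yes refl = ⊥-elim (u≢v refl)
  ... | yes _ | no _ = refl
  ... | no _ | yes _ = refl
  ... | no _ | no _ = refl

data InWalk {n} (G : Graph n) (D : Subset n) : Fin n → Fin n → Set where
  here : ∀ {x} → x ∈ D → InWalk G D x x
  step : ∀ {x y z} → x ∈ D → adj G x y ≡ true → InWalk G D y z → InWalk G D x z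

InducedConnected : ∀ {n} → Graph n → Subset n → Set
InducedConnected G D = ∀ x y → x ∈ D → y ∈ D → InWalk G D x y

Connected : ∀ {n} → Graph n → Set
Connected {n} G = ∀ (x y : Fin n) → InWalk G ⊤ x y

Dominating : ∀ {n} → Graph n → Subset n → Set
Dominating {n} G D = ∀ (x : Fin n) → x ∈ D ⊎ (∃[ y ] (y ∈ D × adj G x y ≡ true))

IsCDS : ∀ {n} → Graph n → Subset n → Set
IsCDS G D = Dominating G D × InducedConnected G D

γc≡ : ∀ {n} → Graph n → ℕ → Set
γc≡ G k = (∃[ D ] (IsCDS G D × ∣ D ∣ ≡ k)) × (∀ D → IsCDS G D → k ≤ ∣ D ∣)

γc< : ∀ {n} → Graph n → ℕ → Set
γc< G k = ∃[ D ] (IsCDS G D × ∣ D ∣ < k)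

TwoConnected : ∀ {n} → Graph n → Set
TwoConnected {n} G = 3 ≤ n × Connected G × (∀ v → Connected (G -ᵛ v))

EdgeCritical : ∀ {n} → Graph n → ℕ → Set
EdgeCritical G k = γc≡ G k ×
  (∀ u v → (u≢v : ¬ (u ≡ v)) → adj G u v ≡ false → γc< (addEdge G u v u≢v) k)

VertexCritical : ∀ {n} → Graph n → ℕ → Set
VertexCritical G k = TwoConnected G × γc≡ G k × (∀ v → γc< (G -ᵛ v) k)

MaximalVertexCritical : ∀ {n} → Graph n → ℕ → Set
MaximalVertexCritical G k = EdgeCritical G k × VertexCritical G k

-- The graph of Lemma 4.8.
-- Vertex (c , i) : Fin 4 × Fin s with class c = 0 (R), 1 (T), 2 (W), 3 (Z),
-- i.e. (0,i)=r_{i+1}, (1,i)=t_{i+1}, (2,i)=w_{i+1}, (3,i)=z_{i+1}.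

-- base c d i j : adjacency listed for ordered class pairs c ≤ d
base : ∀ {s} → Fin 4 → Fin 4 → Fin s → Fin s → Bool
base zero zero i j = not (eqᵇ i j)
base zero (suc zero) i j = not (eqᵇ i j)
base zero (suc (suc zero)) i j = true
base (suc zero) (suc (suc zero)) i j = not (eqᵇ i j)
base (suc zero) (suc (suc (suc zero))) i j = true
base (suc (suc zero)) (suc (suc (suc zero))) i j = not (eqᵇ i j)
base (suc (suc (suc zero))) (suc (suc (suc zero))) i j = not (eqᵇ i j)
base _ _ _ _ = false

adjRTWZ : ∀ {s} → Fin 4 × Fin s → Fin 4 × Fin s → Bool
adjRTWZ (c , i) (d , j) = base c d i j ∨ base d c j i

base-diag : ∀ {s} (c : Fin 4) (i : Fin s) → base c c i i ≡ false
base-diag zero i rewrite eqᵇ-refl i = refl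
base-diag (suc zero) i = refl
base-diag (suc (suc zero)) i = refl
base-diag (suc (suc (suc zero))) i rewrite eqᵇ-refl i = refl

G₄ₛ : (s : ℕ) → Graph (4 * s)
G₄ₛ s = record
  { adj    = λ x y → adjRTWZ (remQuot s x) (remQuot s y)
  ; sym    = λ x y → symR (remQuot s x) (remQuot s y)
  ; irrefl = λ x → irrR (remQuot s x) }
  where
  symR : ∀ p q → adjRTWZ p q ≡ adjRTWZ q p
  symR (c , i) (d , j) = ∨-comm (base c d i j) (base d c j i)
  irrR : ∀ p → adjRTWZ p p ≡ false
  irrR (c , i) rewrite base-diag c i = refl

module Submission where

-- The proof reduces everything to small dominating configurations in a graph:
--  * an edge ab whose closed neighbourhoods cover the graph is a connected
--    dominating set (CDS) of size at most 2, and a path abc covering it is one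
--    of size at most 3 (both are stars around a centre, hence connected);
--  * if no vertex and no edge dominates, every CDS has at least 3 members:
--    a CDS contains an edge, and that edge leaves some vertex undominated;
--  * in G + uv and in G - v such a dominating edge witnesses γc < 3.
-- In G₄ₛ s adjacency of two vertices depends only on their classes R, T, W, Z
-- and on whether their indices coincide, and every statement we need mentions
-- at most two indices i ≠ j.  So relative to a frame (i, j) each vertex has a
-- profile (its class, and whether its index is i, j or neither), the named
-- vertices c_i, c_j are profiles, and the concrete facts (the dominating path
-- r_i t_j z_i, vertices and edges that do not dominate, the dominating edges
-- of G + uv and G - v) become Boolean statements about the 12 profiles,
-- decided by evaluation and transported back to G.  The argument needs only
-- two distinct indices, i.e. s ≥ 2; the theorem assembles the pieces.

open import Defs hiding (sym)
open import Data.Nat using (ℕ; zero; suc; _≤_; _+_; _*_; z≤n; s≤s)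
open import Data.Nat.Properties using (≤-trans; ≤-reflexive; ≤-antisym; +-suc; +-mono-≤; +-monoʳ-≤; n≤1+n; m≤n*m)
open import Data.Fin using (Fin; zero; suc; punchIn; punchOut; combine; remQuot; _≟_)
open import Data.Fin.Properties using (punchIn-punchOut; punchInᵢ≢i; punchIn-injective; remQuot-combine; combine-remQuot; combine-injectiveˡ; combine-injectiveʳ)
open import Data.Fin.Subset using (Subset; _∈_; ∣_∣; ⊤; ⁅_⁆; _∪_; _-_; inside; outside)
open import Data.Fin.Subset.Properties using (∈⊤; x∈⁅x⁆; x∈⁅y⁆⇒x≡y; x∈p∪q⁻; x∈p∪q⁺; ∣⁅x⁆∣≡1; x∈p⇒∣p-x∣<∣p∣; x∈p∧x≢y⇒x∈p-y)
open import Data.Vec using ([]; _∷_)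
open import Data.Bool using (Bool; true; false; _∨_; _∧_; not)
open import Data.Bool.Properties using (∨-zeroʳ; ∨-conicalˡ; ∨-conicalʳ; ∧-conicalˡ; ∧-conicalʳ; not-injective)
open import Data.Maybe using (Maybe; just; nothing)
open import Data.Product using (_×_; _,_; Σ; ∃-syntax; proj₁; proj₂)
open import Data.Sum using (_⊎_; inj₁; inj₂)
open import Data.Empty using (⊥-elim)
open import Function using (_∘_)
open import Relation.Nullary using (¬_; yes; no)
open import Relation.Nullary.Decidable using (dec-true; dec-false)
open import Relation.Binary.PropositionalEquality using (_≡_; _≢_; refl; sym; trans; cong; cong₂; subst; subst₂; module ≡-Reasoning)

∨-split : ∀ a {b} → (a ∨ b) ≡ true → a ≡ true ⊎ b ≡ true
∨-split true  _ = inj₁ refl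
∨-split false h = inj₂ h

not-true : ∀ {b} → not b ≡ true → b ≡ false
not-true = not-injective

implied : ∀ {a b} → (not a ∨ b) ≡ true → a ≡ true → b ≡ true
implied h refl = h

resolve : ∀ {a b} → a ≡ false → (a ∨ b) ≡ true → b ≡ true
resolve refl h = h

true≢false : true ≢ false
true≢false ()

module _ {n : ℕ} where

  eqᵇ⇒≡ : {x y : Fin n} → eqᵇ x y ≡ true → x ≡ y
  eqᵇ⇒≡ {x} {y} h with x ≟ y
  ... | yes x≡y = x≡y
  ... | no _ = ⊥-elim (true≢false (sym h))

  eqᵇ-false⇒≢ : {x y : Fin n} → eqᵇ x y ≡ false → x ≢ y
  eqᵇ-false⇒≢ {x} h refl = true≢false (trans (sym (eqᵇ-refl x)) h)

  ≢⇒eqᵇ-false : {x y : Fin n} → x ≢ y → eqᵇ x y ≡ false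
  ≢⇒eqᵇ-false {x} {y} = dec-false (x ≟ y)

  eqᵇ-sym : (x y : Fin n) → eqᵇ x y ≡ eqᵇ y x
  eqᵇ-sym x y with eqᵇ x y in x≟y
  ... | true  = sym (dec-true (y ≟ x) (sym (eqᵇ⇒≡ x≟y)))
  ... | false = sym (≢⇒eqᵇ-false {y} {x} (λ y≡x → eqᵇ-false⇒≢ x≟y (sym y≡x)))

module _ {n : ℕ} (G : Graph n) where

  Near : Fin n → Fin n → Set
  Near x a = x ≡ a ⊎ adj G x a ≡ true

  nearᵇ : Fin n → Fin n → Bool
  nearᵇ x a = eqᵇ x a ∨ adj G x a

  nearᵇ⇒Near : ∀ {x a} → nearᵇ x a ≡ true → Near x a
  nearᵇ⇒Near {x} {a} h with ∨-split (eqᵇ x a) h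
  ... | inj₁ x≟a = inj₁ (eqᵇ⇒≡ {x = x} x≟a)
  ... | inj₂ x~a = inj₂ x~a

  Near⇒nearᵇ : ∀ {x a} → Near x a → nearᵇ x a ≡ true
  Near⇒nearᵇ {x}     (inj₁ refl) rewrite eqᵇ-refl x = refl
  Near⇒nearᵇ {x} {a} (inj₂ x~a)  rewrite x~a = ∨-zeroʳ (eqᵇ x a)

  adj-flip : ∀ {x y} → adj G x y ≡ true → adj G y x ≡ true
  adj-flip {x} {y} x~y = trans (Graph.sym G y x) x~y

  adj⇒≢ : ∀ {x y} → adj G x y ≡ true → x ≢ y
  adj⇒≢ {x} x~x refl = true≢false (trans (sym x~x) (irrefl G x))

  near-apart : ∀ {u d a} → Near u d → ¬ Near u a → d ≢ a
  near-apart u~d u≁a refl = u≁a u~d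

  walk-++ : ∀ {D x y z} → InWalk G D x y → InWalk G D y z → InWalk G D x z
  walk-++ (here _)          w′ = w′
  walk-++ (step x∈D x~y w) w′ = step x∈D x~y (walk-++ w w′)

  walk-widen : ∀ {D x y} → InWalk G D x y → InWalk G ⊤ x y
  walk-widen (here _)        = here ∈⊤
  walk-widen (step _ x~y w)  = step ∈⊤ x~y (walk-widen w)

  walk-start : ∀ {D x y} → InWalk G D x y → x ∈ D
  walk-start (here x∈D)     = x∈D
  walk-start (step x∈D _ _) = x∈D

  first-step : ∀ {D x y} → InWalk G D x y → x ≢ y → ∃[ e ] (e ∈ D × adj G x e ≡ true)
  first-step (here _)       x≢x = ⊥-elim (x≢x refl)
  first-step (step _ x~e w) _   = _ , walk-start w , x~e

  near-walk : ∀ {D x a} → x ∈ D → a ∈ D → Near x a → InWalk G D x a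
  near-walk _   a∈D (inj₁ refl) = here a∈D
  near-walk x∈D a∈D (inj₂ x~a)  = step x∈D x~a (here a∈D)

  near-walk⁻ : ∀ {D x a} → x ∈ D → a ∈ D → Near x a → InWalk G D a x
  near-walk⁻ x∈D _   (inj₁ refl) = here x∈D
  near-walk⁻ x∈D a∈D (inj₂ x~a)  = step a∈D (adj-flip x~a) (here x∈D)

  dominator : ∀ {D} → Dominating G D → ∀ x → ∃[ d ] (d ∈ D × Near x d)
  dominator dom x with dom x
  ... | inj₁ x∈D             = x , x∈D , inj₁ refl
  ... | inj₂ (d , d∈D , x~d) = d , d∈D , inj₂ x~d

  dominating : ∀ {D} → (∀ x → ∃[ d ] (d ∈ D × Near x d)) → Dominating G D
  dominating cover x with cover x
  ... | d , d∈D , inj₁ refl = inj₁ d∈D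
  ... | d , d∈D , inj₂ x~d  = inj₂ (d , d∈D , x~d)

  cds⇒connected : ∀ {D} → IsCDS G D → Connected G
  cds⇒connected (dom , con) x y with dominator dom x | dominator dom y
  ... | d , d∈D , x~d | d′ , d′∈D , y~d′ =
    walk-++ (near-walk ∈⊤ ∈⊤ x~d)
      (walk-++ (walk-widen (con d d′ d∈D d′∈D)) (near-walk⁻ ∈⊤ ∈⊤ y~d′))

  star-cds : ∀ {D h} → h ∈ D → (∀ {x} → x ∈ D → Near x h) →
             (∀ x → ∃[ d ] (d ∈ D × Near x d)) → IsCDS G D
  star-cds {D} h∈D hub cover = dominating cover , connected
    where
    connected : InducedConnected G D
    connected x y x∈D y∈D = walk-++ (near-walk x∈D h∈D (hub x∈D)) (near-walk⁻ y∈D h∈D (hub y∈D))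

∣p∪q∣≤∣p∣+∣q∣ : ∀ {n} (p q : Subset n) → ∣ p ∪ q ∣ ≤ ∣ p ∣ + ∣ q ∣
∣p∪q∣≤∣p∣+∣q∣ []            []            = z≤n
∣p∪q∣≤∣p∣+∣q∣ (outside ∷ p) (outside ∷ q) = ∣p∪q∣≤∣p∣+∣q∣ p q
∣p∪q∣≤∣p∣+∣q∣ (inside  ∷ p) (outside ∷ q) = s≤s (∣p∪q∣≤∣p∣+∣q∣ p q)
∣p∪q∣≤∣p∣+∣q∣ (outside ∷ p) (inside  ∷ q) rewrite +-suc ∣ p ∣ ∣ q ∣ = s≤s (∣p∪q∣≤∣p∣+∣q∣ p q)
∣p∪q∣≤∣p∣+∣q∣ (inside  ∷ p) (inside  ∷ q) =
  s≤s (≤-trans (∣p∪q∣≤∣p∣+∣q∣ p q) (+-monoʳ-≤ ∣ p ∣ (n≤1+n ∣ q ∣)))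

∣⁅a⁆∪⁅b⁆∣≤2 : ∀ {n} (a b : Fin n) → ∣ ⁅ a ⁆ ∪ ⁅ b ⁆ ∣ ≤ 2
∣⁅a⁆∪⁅b⁆∣≤2 a b = ≤-trans (∣p∪q∣≤∣p∣+∣q∣ ⁅ a ⁆ ⁅ b ⁆) (≤-reflexive (cong₂ _+_ (∣⁅x⁆∣≡1 a) (∣⁅x⁆∣≡1 b)))

-- removing the three members one at a time strictly decreases the size each time
three-members : ∀ {n} {D : Subset n} {a b c} → a ∈ D → b ∈ D → c ∈ D →
                a ≢ b → a ≢ c → b ≢ c → 3 ≤ ∣ D ∣
three-members {D = D} {a} {b} {c} a∈D b∈D c∈D a≢b a≢c b≢c =
  ≤-trans (s≤s (≤-trans (s≤s (≤-trans (s≤s z≤n) (x∈p⇒∣p-x∣<∣p∣ c∈D-a-b)))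
                        (x∈p⇒∣p-x∣<∣p∣ b∈D-a)))
          (x∈p⇒∣p-x∣<∣p∣ a∈D)
  where
  b∈D-a : b ∈ D - a
  b∈D-a = x∈p∧x≢y⇒x∈p-y b∈D (a≢b ∘ sym)
  c∈D-a-b : c ∈ D - a - b
  c∈D-a-b = x∈p∧x≢y⇒x∈p-y (x∈p∧x≢y⇒x∈p-y c∈D (a≢c ∘ sym)) (b≢c ∘ sym)

-- Small connected dominating sets, and the lower bound γc ≥ 3

module _ {n : ℕ} (G : Graph n) where

  dominating-edge : ∀ {a b} → adj G a b ≡ true → (∀ x → Near G x a ⊎ Near G x b) → γc< G 3
  dominating-edge {a} {b} a~b cover =
    ⁅ a ⁆ ∪ ⁅ b ⁆ , star-cds G a∈D hub dom , s≤s (∣⁅a⁆∪⁅b⁆∣≤2 a b)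
    where
    a∈D : a ∈ ⁅ a ⁆ ∪ ⁅ b ⁆
    a∈D = x∈p∪q⁺ (inj₁ (x∈⁅x⁆ a))
    b∈D : b ∈ ⁅ a ⁆ ∪ ⁅ b ⁆
    b∈D = x∈p∪q⁺ (inj₂ (x∈⁅x⁆ b))
    hub : ∀ {x} → x ∈ ⁅ a ⁆ ∪ ⁅ b ⁆ → Near G x a
    hub x∈D with x∈p∪q⁻ ⁅ a ⁆ ⁅ b ⁆ x∈D
    ... | inj₁ x∈⁅a⁆ with refl ← x∈⁅y⁆⇒x≡y a x∈⁅a⁆ = inj₁ refl
    ... | inj₂ x∈⁅b⁆ with refl ← x∈⁅y⁆⇒x≡y b x∈⁅b⁆ = inj₂ (adj-flip G a~b)
    dom : ∀ x → ∃[ d ] (d ∈ ⁅ a ⁆ ∪ ⁅ b ⁆ × Near G x d)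
    dom x with cover x
    ... | inj₁ x~a = a , a∈D , x~a
    ... | inj₂ x~b = b , b∈D , x~b

  dominating-path : ∀ {a b c} → adj G a b ≡ true → adj G b c ≡ true →
                    (∀ x → Near G x a ⊎ Near G x b ⊎ Near G x c) →
                    ∃[ D ] (IsCDS G D × ∣ D ∣ ≤ 3)
  dominating-path {a} {b} {c} a~b b~c cover =
    D , star-cds G b∈D hub dom , ≤-trans (∣p∪q∣≤∣p∣+∣q∣ (⁅ a ⁆ ∪ ⁅ b ⁆) ⁅ c ⁆) size
    where
    D : Subset n
    D = (⁅ a ⁆ ∪ ⁅ b ⁆) ∪ ⁅ c ⁆
    a∈D : a ∈ D
    a∈D = x∈p∪q⁺ (inj₁ (x∈p∪q⁺ (inj₁ (x∈⁅x⁆ a))))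
    b∈D : b ∈ D
    b∈D = x∈p∪q⁺ (inj₁ (x∈p∪q⁺ (inj₂ (x∈⁅x⁆ b))))
    c∈D : c ∈ D
    c∈D = x∈p∪q⁺ (inj₂ (x∈⁅x⁆ c))
    size : ∣ ⁅ a ⁆ ∪ ⁅ b ⁆ ∣ + ∣ ⁅ c ⁆ ∣ ≤ 3
    size = +-mono-≤ (∣⁅a⁆∪⁅b⁆∣≤2 a b) (≤-reflexive (∣⁅x⁆∣≡1 c))
    hub : ∀ {x} → x ∈ D → Near G x b
    hub x∈D with x∈p∪q⁻ (⁅ a ⁆ ∪ ⁅ b ⁆) ⁅ c ⁆ x∈D
    ... | inj₂ x∈⁅c⁆ with refl ← x∈⁅y⁆⇒x≡y c x∈⁅c⁆ = inj₂ (adj-flip G b~c)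
    ... | inj₁ x∈ab with x∈p∪q⁻ ⁅ a ⁆ ⁅ b ⁆ x∈ab
    ...   | inj₁ x∈⁅a⁆ with refl ← x∈⁅y⁆⇒x≡y a x∈⁅a⁆ = inj₂ a~b
    ...   | inj₂ x∈⁅b⁆ with refl ← x∈⁅y⁆⇒x≡y b x∈⁅b⁆ = inj₁ refl
    dom : ∀ x → ∃[ d ] (d ∈ D × Near G x d)
    dom x with cover x
    ... | inj₁ x~a        = a , a∈D , x~a
    ... | inj₂ (inj₁ x~b) = b , b∈D , x~b
    ... | inj₂ (inj₂ x~c) = c , c∈D , x~c

  -- if no vertex and no edge dominates G, every CDS has at least three vertices:
  -- a CDS D contains some d₁, and a second member d₂ dominating a vertex that d₁
  -- misses; a walk in D from d₁ to d₂ gives an edge d₁e in D, and a vertex that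
  -- this edge misses is dominated by a third member d₃ of D.
  γc≥3 : Fin n → (∀ a → ∃[ u ] ¬ Near G u a) →
         (∀ a b → adj G a b ≡ true → ∃[ u ] (¬ Near G u a × ¬ Near G u b)) →
         ∀ D → IsCDS G D → 3 ≤ ∣ D ∣
  γc≥3 x₀ undominated-by-vertex undominated-by-edge D (dom , con) =
    let d₁ , d₁∈D , _    = dominator G dom x₀
        u , u≁d₁         = undominated-by-vertex d₁
        d₂ , d₂∈D , u~d₂ = dominator G dom u
        e , e∈D , d₁~e   = first-step G (con d₁ d₂ d₁∈D d₂∈D) (near-apart G u~d₂ u≁d₁ ∘ sym)
        w , w≁d₁ , w≁e   = undominated-by-edge d₁ e d₁~e
        d₃ , d₃∈D , w~d₃ = dominator G dom w
    in three-members d₁∈D e∈D d₃∈D (adj⇒≢ G d₁~e)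
         (near-apart G w~d₃ w≁d₁ ∘ sym) (near-apart G w~d₃ w≁e ∘ sym)

added-edge-cds : ∀ {n} (G : Graph n) {u v b} (u≢v : u ≢ v) → b ≡ v ⊎ adj G u b ≡ true →
                 (∀ x → x ≡ v ⊎ Near G x u ⊎ Near G x b) → γc< (addEdge G u v u≢v) 3
added-edge-cds {n} G {u} {v} {b} u≢v u~b cover = dominating-edge H (u~ᴴb u~b) coverᴴ
  where
  H : Graph n
  H = addEdge G u v u≢v
  lift : ∀ {x y} → adj G x y ≡ true → adj H x y ≡ true
  lift x~y rewrite x~y = refl
  lift-near : ∀ {x a} → Near G x a → Near H x a
  lift-near (inj₁ x≡a) = inj₁ x≡a
  lift-near (inj₂ x~a) = inj₂ (lift x~a)
  v~ᴴu : adj H v u ≡ true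
  v~ᴴu rewrite eqᵇ-refl u | eqᵇ-refl v =
    trans (cong (adj G v u ∨_) (∨-zeroʳ (eqᵇ v u ∧ eqᵇ u v))) (∨-zeroʳ (adj G v u))
  u~ᴴb : b ≡ v ⊎ adj G u b ≡ true → adj H u b ≡ true
  u~ᴴb (inj₁ refl) = adj-flip H v~ᴴu
  u~ᴴb (inj₂ u~b′) = lift u~b′
  coverᴴ : ∀ x → Near H x u ⊎ Near H x b
  coverᴴ x with cover x
  ... | inj₁ refl       = inj₁ (inj₂ v~ᴴu)
  ... | inj₂ (inj₁ x~u) = inj₁ (lift-near x~u)
  ... | inj₂ (inj₂ x~b) = inj₂ (lift-near x~b)

deleted-vertex-cds : ∀ {n} (G : Graph n) (v : Fin n) {a b} → a ≢ v → b ≢ v → adj G a b ≡ true →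
                     (∀ x → x ≡ v ⊎ Near G x a ⊎ Near G x b) → γc< (G -ᵛ v) 3
deleted-vertex-cds {suc _} G v {a} {b} a≢v b≢v a~b cover =
  dominating-edge (G -ᵛ v) a′~b′ cover′
  where
  v≢a : v ≢ a
  v≢a = a≢v ∘ sym
  v≢b : v ≢ b
  v≢b = b≢v ∘ sym
  a′~b′ : adj (G -ᵛ v) (punchOut v≢a) (punchOut v≢b) ≡ true
  a′~b′ = subst₂ (λ x y → adj G x y ≡ true) (sym (punchIn-punchOut v≢a)) (sym (punchIn-punchOut v≢b)) a~b
  restrict : ∀ {x c} (v≢c : v ≢ c) → Near G (punchIn v x) c → Near (G -ᵛ v) x (punchOut v≢c)
  restrict {x} v≢c x~c with punchOut v≢c | punchIn-punchOut v≢c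
  ... | c′ | refl with x~c
  ...   | inj₁ x≡c = inj₁ (punchIn-injective v x c′ x≡c)
  ...   | inj₂ x~c′ = inj₂ x~c′
  cover′ : ∀ x → Near (G -ᵛ v) x (punchOut v≢a) ⊎ Near (G -ᵛ v) x (punchOut v≢b)
  cover′ x with cover (punchIn v x)
  ... | inj₁ x≡v        = ⊥-elim (punchInᵢ≢i v x x≡v)
  ... | inj₂ (inj₁ x~a) = inj₁ (restrict v≢a x~a)
  ... | inj₂ (inj₂ x~b) = inj₂ (restrict v≢b x~b)

pattern R = zero
pattern T = suc zero
pattern W = suc (suc zero)
pattern Z = suc (suc (suc zero))

link : Fin 4 → Fin 4 → Bool → Bool
link R R same = not same
link R T same = not same
link R W _    = true
link T W same = not same
link T Z _    = true
link W Z same = not same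
link Z Z same = not same
link _ _ _    = false

linked : Fin 4 → Fin 4 → Bool → Bool
linked c d same = link c d same ∨ link d c same

base-link : ∀ {s} c d (k l : Fin s) → base c d k l ≡ link c d (eqᵇ k l)
base-link R R _ _ = refl
base-link R T _ _ = refl
base-link R W _ _ = refl
base-link R Z _ _ = refl
base-link T R _ _ = refl
base-link T T _ _ = refl
base-link T W _ _ = refl
base-link T Z _ _ = refl
base-link W R _ _ = refl
base-link W T _ _ = refl
base-link W W _ _ = refl
base-link W Z _ _ = refl
base-link Z R _ _ = refl
base-link Z T _ _ = refl
base-link Z W _ _ = refl
base-link Z Z _ _ = refl

module Vertices (s : ℕ) where

  vertex : Fin 4 → Fin s → Fin (4 * s)
  vertex = combine

  vertex-elim : (P : Fin (4 * s) → Set) → (∀ c k → P (vertex c k)) → ∀ x → P x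
  vertex-elim P f x = subst P (combine-remQuot {4} s x) (f (proj₁ (remQuot s x)) (proj₂ (remQuot s x)))

  adj-vertex : ∀ c k d l → adj (G₄ₛ s) (vertex c k) (vertex d l) ≡ linked c d (eqᵇ k l)
  adj-vertex c k d l = begin
    adj (G₄ₛ s) (vertex c k) (vertex d l)     ≡⟨ cong₂ adjRTWZ (remQuot-combine c k) (remQuot-combine d l) ⟩
    base c d k l ∨ base d c l k                ≡⟨ cong₂ _∨_ (base-link c d k l) (base-link d c l k) ⟩
    link c d (eqᵇ k l) ∨ link d c (eqᵇ l k)    ≡⟨ cong (λ same → link c d (eqᵇ k l) ∨ link d c same) (eqᵇ-sym l k) ⟩
    linked c d (eqᵇ k l)                       ∎
    where open ≡-Reasoning

  eqᵇ-vertex : ∀ c k d l → eqᵇ (vertex c k) (vertex d l) ≡ eqᵇ c d ∧ eqᵇ k l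
  eqᵇ-vertex c k d l with eqᵇ c d in c≟d | eqᵇ k l in k≟l
  ... | false | _     = ≢⇒eqᵇ-false (eqᵇ-false⇒≢ c≟d ∘ combine-injectiveˡ c k d l)
  ... | true  | false = ≢⇒eqᵇ-false (eqᵇ-false⇒≢ k≟l ∘ combine-injectiveʳ c k d l)
  ... | true  | true  with refl ← eqᵇ⇒≡ {x = c} c≟d | refl ← eqᵇ⇒≡ {x = k} k≟l = eqᵇ-refl (vertex c k)

-- Profiles: vertices seen from a frame of two distinct indices i, j

data Ix : Set where
  ᵢ ⱼ : Ix

Named : Set
Named = Fin 4 × Ix

-- an arbitrary vertex: its class, and its index if that is i or j
Profile : Set
Profile = Fin 4 × Maybe Ix

embed : Named → Profile
embed (c , y) = c , just y

hits : Maybe Ix → Ix → Bool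
hits (just ᵢ) ᵢ = true
hits (just ⱼ) ⱼ = true
hits _        _ = false

sameᵖ : Profile → Named → Bool
sameᵖ (c , p) (d , y) = eqᵇ c d ∧ hits p y

adjᵖ : Profile → Named → Bool
adjᵖ (c , p) (d , y) = linked c d (hits p y)

nearᵖ : Profile → Named → Bool
nearᵖ x a = sameᵖ x a ∨ adjᵖ x a

everyClass : (Fin 4 → Bool) → Bool
everyClass f = f R ∧ f T ∧ f W ∧ f Z

everyClass-sound : ∀ f → everyClass f ≡ true → ∀ c → f c ≡ true
everyClass-sound f h R = ∧-conicalˡ (f R) _ h
everyClass-sound f h T = ∧-conicalˡ (f T) _ (∧-conicalʳ (f R) _ h)
everyClass-sound f h W = ∧-conicalˡ (f W) _ (∧-conicalʳ (f T) _ (∧-conicalʳ (f R) _ h))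
everyClass-sound f h Z = ∧-conicalʳ (f W) _ (∧-conicalʳ (f T) _ (∧-conicalʳ (f R) _ h))

everyIx : (Ix → Bool) → Bool
everyIx f = f ᵢ ∧ f ⱼ

everyIx-sound : ∀ f → everyIx f ≡ true → ∀ y → f y ≡ true
everyIx-sound f h ᵢ = ∧-conicalˡ (f ᵢ) _ h
everyIx-sound f h ⱼ = ∧-conicalʳ (f ᵢ) _ h

everyProfile : (Profile → Bool) → Bool
everyProfile f = everyClass (λ c → everyIx (λ y → f (c , just y)) ∧ f (c , nothing))

everyProfile-sound : ∀ f → everyProfile f ≡ true → ∀ x → f x ≡ true
everyProfile-sound f h (c , p) = at p (everyClass-sound classwise h c)
  where
  classwise : Fin 4 → Bool
  classwise c = everyIx (λ y → f (c , just y)) ∧ f (c , nothing)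
  at : ∀ p → classwise c ≡ true → f (c , p) ≡ true
  at (just y) h′ = everyIx-sound (λ y → f (c , just y)) (∧-conicalˡ _ (f (c , nothing)) h′) y
  at nothing  h′ = ∧-conicalʳ (everyIx (λ y → f (c , just y))) _ h′

-- pairs (c_i, d_y) of named vertices; up to renaming the first index is always i
everyPair : (Fin 4 → Fin 4 → Ix → Bool) → Bool
everyPair f = everyClass (λ c → everyClass (λ d → everyIx (f c d)))

everyPair-sound : ∀ f → everyPair f ≡ true → ∀ c d y → f c d y ≡ true
everyPair-sound f h c d = everyIx-sound (f c d)
  (everyClass-sound (λ d → everyIx (f c d)) (everyClass-sound (λ c → everyClass (λ d → everyIx (f c d))) h c) d)

coversBesides : Named → Named → Named → Bool
coversBesides v a b = everyProfile (λ x → sameᵖ x v ∨ nearᵖ x a ∨ nearᵖ x b)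

pathCovers : Bool
pathCovers = everyProfile (λ x → nearᵖ x (R , ᵢ) ∨ nearᵖ x (T , ⱼ) ∨ nearᵖ x (Z , ᵢ))

stranger : Fin 4 → Named
stranger R = Z , ᵢ
stranger T = T , ⱼ
stranger W = W , ⱼ
stranger Z = R , ᵢ

strangerOK : Fin 4 → Bool
strangerOK c = not (nearᵖ (embed (stranger c)) (c , ᵢ))

blocker : Fin 4 → Fin 4 → Ix → Named
blocker R R _ = Z , ᵢ
blocker R T _ = T , ᵢ
blocker R W y = Z , y
blocker T R _ = T , ⱼ
blocker T W _ = T , ⱼ
blocker T Z _ = R , ᵢ
blocker W R _ = Z , ᵢ
blocker W T _ = T , ᵢ
blocker W Z _ = W , ⱼ
blocker Z T y = R , y
blocker Z W _ = W , ᵢ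
blocker Z Z _ = R , ᵢ
blocker _ _ _ = R , ᵢ

blockerOK : Fin 4 → Fin 4 → Ix → Bool
blockerOK c d y = not (adjᵖ (embed (c , ᵢ)) (d , y)) ∨ not (nearᵖ w (c , ᵢ) ∨ nearᵖ w (d , y))
  where
  w : Profile
  w = embed (blocker c d y)

-- for a non-edge u = c_i, v = d_y the edge ub of G + uv dominates it: b = v except
-- for two vertices of T (b = r_j) or of W (b = z_j)
partner : Fin 4 → Fin 4 → Ix → Named
partner T T ⱼ = R , ⱼ
partner W W ⱼ = Z , ⱼ
partner _ d y = d , y

partnerOK : Fin 4 → Fin 4 → Ix → Bool
partnerOK c d y = sameᵖ u v ∨ adjᵖ u v ∨ ((sameᵖ (embed b) v ∨ adjᵖ u b) ∧ coversBesides v (c , ᵢ) b)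
  where
  u : Profile
  u = embed (c , ᵢ)
  v : Named
  v = d , y
  b : Named
  b = partner c d y

deletionPair : Fin 4 → Named × Named
deletionPair R = (T , ᵢ) , (Z , ⱼ)
deletionPair T = (R , ᵢ) , (T , ⱼ)
deletionPair W = (W , ⱼ) , (Z , ᵢ)
deletionPair Z = (R , ⱼ) , (W , ᵢ)

avoidsAndCovers : Named → Named × Named → Bool
avoidsAndCovers v (a , b) =
  not (sameᵖ (embed a) v) ∧ not (sameᵖ (embed b) v) ∧ adjᵖ (embed a) b ∧ coversBesides v a b

path-covers : pathCovers ≡ true
path-covers = refl

stranger-ok : ∀ c → strangerOK c ≡ true
stranger-ok = everyClass-sound strangerOK refl

blocker-ok : ∀ c d y → blockerOK c d y ≡ true
blocker-ok = everyPair-sound blockerOK refl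

partner-ok : ∀ c d y → partnerOK c d y ≡ true
partner-ok = everyPair-sound partnerOK refl

deletionPair-ok : ∀ c → avoidsAndCovers (c , ᵢ) (deletionPair c) ≡ true
deletionPair-ok = everyClass-sound (λ c → avoidsAndCovers (c , ᵢ) (deletionPair c)) refl

-- Transporting the configurations to G₄ₛ s, for s ≥ 2

module TheGraph (m : ℕ) where

  s : ℕ
  s = suc (suc m)

  G : Graph (4 * s)
  G = G₄ₛ s

  open Vertices s

  module Frame (i j : Fin s) (i≢j : i ≢ j) where

    idx : Ix → Fin s
    idx ᵢ = i
    idx ⱼ = j

    named : Named → Fin (4 * s)
    named (c , y) = vertex c (idx y)

    locate : Bool → Bool → Maybe Ix
    locate true  _     = just ᵢ
    locate false true  = just ⱼ
    locate false false = nothing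

    pos : Fin s → Maybe Ix
    pos k = locate (eqᵇ k i) (eqᵇ k j)

    eqᵇ-pos : ∀ k y → eqᵇ k (idx y) ≡ hits (pos k) y
    eqᵇ-pos k ᵢ with eqᵇ k i | eqᵇ k j
    ... | true  | _     = refl
    ... | false | true  = refl
    ... | false | false = refl
    eqᵇ-pos k ⱼ with eqᵇ k i in k≟i | eqᵇ k j in k≟j
    ... | true  | true  = ⊥-elim (i≢j (trans (sym (eqᵇ⇒≡ {x = k} k≟i)) (eqᵇ⇒≡ {x = k} k≟j)))
    ... | true  | false = refl
    ... | false | true  = refl
    ... | false | false = refl

    pos-idx : ∀ y → pos (idx y) ≡ just y
    pos-idx ᵢ rewrite eqᵇ-refl i = refl
    pos-idx ⱼ rewrite ≢⇒eqᵇ-false {x = j} {y = i} (i≢j ∘ sym) | eqᵇ-refl j = refl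

    pos-named : ∀ c y → (c , pos (idx y)) ≡ embed (c , y)
    pos-named c y = cong (c ,_) (pos-idx y)

    eqᵇ-transfer : ∀ c k a → eqᵇ (vertex c k) (named a) ≡ sameᵖ (c , pos k) a
    eqᵇ-transfer c k (d , y) = trans (eqᵇ-vertex c k d (idx y)) (cong (eqᵇ c d ∧_) (eqᵇ-pos k y))

    adj-transfer : ∀ c k a → adj G (vertex c k) (named a) ≡ adjᵖ (c , pos k) a
    adj-transfer c k (d , y) = trans (adj-vertex c k d (idx y)) (cong (linked c d) (eqᵇ-pos k y))

    near-transfer : ∀ c k a → nearᵇ G (vertex c k) (named a) ≡ nearᵖ (c , pos k) a
    near-transfer c k a = cong₂ _∨_ (eqᵇ-transfer c k a) (adj-transfer c k a)

    eqᵇ-named : ∀ a b → eqᵇ (named a) (named b) ≡ sameᵖ (embed a) b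
    eqᵇ-named (c , y) b = trans (eqᵇ-transfer c (idx y) b) (cong (λ x → sameᵖ x b) (pos-named c y))

    adj-named : ∀ a b → adj G (named a) (named b) ≡ adjᵖ (embed a) b
    adj-named (c , y) b = trans (adj-transfer c (idx y) b) (cong (λ x → adjᵖ x b) (pos-named c y))

    near-named : ∀ a b → nearᵇ G (named a) (named b) ≡ nearᵖ (embed a) b
    near-named (c , y) b = trans (near-transfer c (idx y) b) (cong (λ x → nearᵖ x b) (pos-named c y))

    distinct : ∀ a b → sameᵖ (embed a) b ≡ false → named a ≢ named b
    distinct a b a≠b = eqᵇ-false⇒≢ (trans (eqᵇ-named a b) a≠b)

    adjacent : ∀ a b → adjᵖ (embed a) b ≡ true → adj G (named a) (named b) ≡ true
    adjacent a b a~b = trans (adj-named a b) a~b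

    far : ∀ a b → nearᵖ (embed a) b ≡ false → ¬ Near G (named a) (named b)
    far a b a≁b a~b = true≢false (trans (sym (Near⇒nearᵇ G a~b)) (trans (near-named a b) a≁b))

    same-sound : ∀ c k a → sameᵖ (c , pos k) a ≡ true → vertex c k ≡ named a
    same-sound c k a x=a = eqᵇ⇒≡ (trans (eqᵇ-transfer c k a) x=a)

    near-sound : ∀ c k a → nearᵖ (c , pos k) a ≡ true → Near G (vertex c k) (named a)
    near-sound c k a x~a = nearᵇ⇒Near G (trans (near-transfer c k a) x~a)

    covers-besides : ∀ v a b → coversBesides v a b ≡ true →
                     ∀ x → x ≡ named v ⊎ Near G x (named a) ⊎ Near G x (named b)
    covers-besides v a b h = vertex-elim _ λ c k → at c k (everyProfile-sound covered h (c , pos k))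
      where
      covered : Profile → Bool
      covered x = sameᵖ x v ∨ nearᵖ x a ∨ nearᵖ x b
      at : ∀ c k → covered (c , pos k) ≡ true →
           vertex c k ≡ named v ⊎ Near G (vertex c k) (named a) ⊎ Near G (vertex c k) (named b)
      at c k h′ with ∨-split (sameᵖ (c , pos k) v) h′
      ... | inj₁ x=v = inj₁ (same-sound c k v x=v)
      ... | inj₂ h″ with ∨-split (nearᵖ (c , pos k) a) h″
      ...   | inj₁ x~a = inj₂ (inj₁ (near-sound c k a x~a))
      ...   | inj₂ x~b = inj₂ (inj₂ (near-sound c k b x~b))

    path-covers-G : ∀ x → Near G x (named (R , ᵢ)) ⊎ Near G x (named (T , ⱼ)) ⊎ Near G x (named (Z , ᵢ))
    path-covers-G = vertex-elim _ λ c k → at c k (everyProfile-sound covered path-covers (c , pos k))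
      where
      covered : Profile → Bool
      covered x = nearᵖ x (R , ᵢ) ∨ nearᵖ x (T , ⱼ) ∨ nearᵖ x (Z , ᵢ)
      at : ∀ c k → covered (c , pos k) ≡ true →
           Near G (vertex c k) (named (R , ᵢ)) ⊎ Near G (vertex c k) (named (T , ⱼ)) ⊎ Near G (vertex c k) (named (Z , ᵢ))
      at c k h with ∨-split (nearᵖ (c , pos k) (R , ᵢ)) h
      ... | inj₁ x~r = inj₁ (near-sound c k (R , ᵢ) x~r)
      ... | inj₂ h′ with ∨-split (nearᵖ (c , pos k) (T , ⱼ)) h′
      ...   | inj₁ x~t = inj₂ (inj₁ (near-sound c k (T , ⱼ) x~t))
      ...   | inj₂ x~z = inj₂ (inj₂ (near-sound c k (Z , ᵢ) x~z))

    rtz-cds : ∃[ D ] (IsCDS G D × ∣ D ∣ ≤ 3)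
    rtz-cds = dominating-path G (adjacent (R , ᵢ) (T , ⱼ) refl) (adjacent (T , ⱼ) (Z , ᵢ) refl) path-covers-G

    stranger-far : ∀ c → ¬ Near G (named (stranger c)) (named (c , ᵢ))
    stranger-far c = far (stranger c) (c , ᵢ) (not-true (stranger-ok c))

    blocker-far : ∀ c d y → adj G (named (c , ᵢ)) (named (d , y)) ≡ true →
                  ¬ Near G (named (blocker c d y)) (named (c , ᵢ)) × ¬ Near G (named (blocker c d y)) (named (d , y))
    blocker-far c d y u~v =
      far w (c , ᵢ) (∨-conicalˡ _ _ w≁uv) , far w (d , y) (∨-conicalʳ (nearᵖ (embed w) (c , ᵢ)) _ w≁uv)
      where
      w : Named
      w = blocker c d y
      w≁uv : (nearᵖ (embed w) (c , ᵢ) ∨ nearᵖ (embed w) (d , y)) ≡ false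
      w≁uv = not-true (implied (blocker-ok c d y) (trans (sym (adj-named (c , ᵢ) (d , y))) u~v))

    added-edge : ∀ c d y (u≢v : named (c , ᵢ) ≢ named (d , y)) → adj G (named (c , ᵢ)) (named (d , y)) ≡ false →
                 γc< (addEdge G (named (c , ᵢ)) (named (d , y)) u≢v) 3
    added-edge c d y u≢v u≁v =
      added-edge-cds G u≢v partner-edge (covers-besides v u b (∧-conicalʳ edge-test _ ok))
      where
      u v b : Named
      u = c , ᵢ
      v = d , y
      b = partner c d y
      -- u ≠ v and uv is not an edge, so partnerOK reduces to its last disjunct
      edge-test : Bool
      edge-test = sameᵖ (embed b) v ∨ adjᵖ (embed u) b
      ok : (edge-test ∧ coversBesides v u b) ≡ true
      ok = resolve (trans (sym (adj-named u v)) u≁v)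
             (resolve (trans (sym (eqᵇ-named u v)) (≢⇒eqᵇ-false u≢v)) (partner-ok c d y))
      partner-edge : named b ≡ named v ⊎ adj G (named u) (named b) ≡ true
      partner-edge with ∨-split (sameᵖ (embed b) v) (∧-conicalˡ _ _ ok)
      ... | inj₁ b=v = inj₁ (eqᵇ⇒≡ (trans (eqᵇ-named b v) b=v))
      ... | inj₂ u~b = inj₂ (adjacent u b u~b)

    deleted : ∀ c → γc< (G -ᵛ named (c , ᵢ)) 3
    deleted c with deletionPair c | deletionPair-ok c
    ... | a , b | ok =
      deleted-vertex-cds G (named v) (distinct a v a≠v) (distinct b v b≠v) (adjacent a b a~b) (covers-besides v a b covers)
      where
      v : Named
      v = c , ᵢ
      a≠v : sameᵖ (embed a) v ≡ false
      a≠v = not-true (∧-conicalˡ _ _ ok)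
      b≠v-and-rest : (not (sameᵖ (embed b) v) ∧ adjᵖ (embed a) b ∧ coversBesides v a b) ≡ true
      b≠v-and-rest = ∧-conicalʳ (not (sameᵖ (embed a) v)) _ ok
      b≠v : sameᵖ (embed b) v ≡ false
      b≠v = not-true (∧-conicalˡ _ _ b≠v-and-rest)
      a~b-and-covers : (adjᵖ (embed a) b ∧ coversBesides v a b) ≡ true
      a~b-and-covers = ∧-conicalʳ (not (sameᵖ (embed b) v)) _ b≠v-and-rest
      a~b : adjᵖ (embed a) b ≡ true
      a~b = ∧-conicalˡ _ _ a~b-and-covers
      covers : coversBesides v a b ≡ true
      covers = ∧-conicalʳ (adjᵖ (embed a) b) _ a~b-and-covers

  -- every index k has a partner j ≠ k (here s ≥ 2 is used)
  another : (k : Fin s) → ∃[ j ] k ≢ j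
  another k = punchIn k zero , λ k≡j → punchInᵢ≢i k zero (sym k≡j)

  Framing : Fin s → Fin s → Set
  Framing k l = ∃[ j ] Σ (k ≢ j) λ k≢j → ∃[ y ] l ≡ Frame.idx k j k≢j y

  frame-for : (k l : Fin s) → Framing k l
  frame-for k l with l ≟ k
  ... | yes refl = let j , k≢j = another k in j , k≢j , ᵢ , refl
  ... | no l≢k   = l , l≢k ∘ sym , ⱼ , refl

  single-elim : (P : Fin (4 * s) → Set) →
                (∀ i j (i≢j : i ≢ j) c → P (Frame.named i j i≢j (c , ᵢ))) → ∀ v → P v
  single-elim P f = vertex-elim P λ c k → let j , k≢j = another k in f k j k≢j c

  pair-elim : (P : Fin (4 * s) → Fin (4 * s) → Set) →
              (∀ i j (i≢j : i ≢ j) c d y → P (Frame.named i j i≢j (c , ᵢ)) (Frame.named i j i≢j (d , y))) →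
              ∀ u v → P u v
  pair-elim P f = vertex-elim _ λ c k → vertex-elim _ λ d l → framed c k d l (frame-for k l)
    where
    framed : ∀ c k d l → Framing k l → P (vertex c k) (vertex d l)
    framed c k d _ (j , k≢j , y , refl) = f k j k≢j c d y

  no-dominating-vertex : ∀ a → ∃[ u ] ¬ Near G u a
  no-dominating-vertex = single-elim _ λ i j i≢j c →
    Frame.named i j i≢j (stranger c) , Frame.stranger-far i j i≢j c

  no-dominating-edge : ∀ a b → adj G a b ≡ true → ∃[ u ] (¬ Near G u a × ¬ Near G u b)
  no-dominating-edge = pair-elim _ λ i j i≢j c d y a~b →
    Frame.named i j i≢j (blocker c d y) , Frame.blocker-far i j i≢j c d y a~b

  γc≡3 : γc≡ G 3
  γc≡3 = let D , D-cds , ∣D∣≤3 = Frame.rtz-cds zero (suc zero) (λ ()) in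
         (D , D-cds , ≤-antisym ∣D∣≤3 (at-least-3 D D-cds)) , at-least-3
    where
    at-least-3 : ∀ D → IsCDS G D → 3 ≤ ∣ D ∣
    at-least-3 = γc≥3 G (vertex R zero) no-dominating-vertex no-dominating-edge

  edge-critical : ∀ u v (u≢v : u ≢ v) → adj G u v ≡ false → γc< (addEdge G u v u≢v) 3
  edge-critical = pair-elim _ λ i j i≢j c d y → Frame.added-edge i j i≢j c d y

  vertex-critical : ∀ v → γc< (G -ᵛ v) 3
  vertex-critical = single-elim _ λ i j i≢j c → Frame.deleted i j i≢j c

lemma4p8 : (s : ℕ) → 3 ≤ s → MaximalVertexCritical (G₄ₛ s) 3
lemma4p8 zero          ()
lemma4p8 (suc zero)    (s≤s ())
lemma4p8 (suc (suc m)) 3≤s = (γc≡3 , edge-critical) , (two-connected , γc≡3 , vertex-critical)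
  where
  open TheGraph m
  -- G has at least 3 vertices, and G and every G - v have a CDS, so are connected
  two-connected : TwoConnected G
  two-connected =
    ≤-trans 3≤s (m≤n*m s 4) ,
    cds⇒connected G (proj₁ (proj₂ (proj₁ γc≡3))) ,
    λ v → cds⇒connected (G -ᵛ v) (proj₁ (proj₂ (vertex-critical v)))
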